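{- Let $F$ be a strictly $2$-balanced graph and let $H=F_1\cup F_2$ be the union of two distinct copies $F_1,F_2$ of $F$ which share at least two edges. Then $d_2(H)>d_2(F)$.
   Context: For a graph $F$ with at least one edge, $d_2(F)=\frac{|E(F)|-1}{|V(F)|-2}$ if $|V(F)|\ge 3$ and $d_2(K_2)=1$. A graph $F$ with at least two edges is strictly $2$-balanced if $d_2(F)>d_2(F')$ for every proper subgraph $F'\subsetneq F$ with at least one edge. Copies of $F$ are graphs isomorphic to $F$; $F_1\cup F_2$ has vertex set $V(F_1)\cup V(F_2)$ and edge set $E(F_1)\cup E(F_2)$. -}

module Defs where

open import Data.Bool using (Bool; true; false; _∧_; _∨_)
open import Data.Nat using (ℕ; zero; suc; _≤_; _<ᵇ_)
open import Data.Fin using (Fin; toℕ)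
open import Data.Fin.Subset using (Subset; _∈_; _∪_; ∣_∣)
open import Data.Fin.Subset.Properties using (x∈p∪q⁺)
open import Data.List using (List; length; filterᵇ; concatMap; map; allFin)
open import Data.Product using (Σ; ∃; _×_; _,_)
open import Data.Sum using (inj₁; inj₂)
open import Data.Integer using (ℤ; +_; _-_)
open import Data.Rational using (ℚ; _/_; 1ℚ; 0ℚ; _<_)
open import Relation.Binary.PropositionalEquality using (_≡_; refl; cong₂)
open import Relation.Nullary using (¬_)

record Graph (n : ℕ) : Set where
  field
    V      : Subset n
    E      : Fin n → Fin n → Bool
    sym    : ∀ i j → E i j ≡ E j i
    irrefl : ∀ i → E i i ≡ false
    closed : ∀ i j → E i j ≡ true → i ∈ V
open Graph public

pairs : (n : ℕ) → List (Fin n × Fin n)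
pairs n = concatMap (λ i → map (λ j → (i , j)) (allFin n)) (allFin n)

ecount : ∀ {n} → (Fin n → Fin n → Bool) → ℕ
ecount {n} A = length (filterᵇ (λ { (i , j) → (toℕ i <ᵇ toℕ j) ∧ A i j }) (pairs n))

eG : ∀ {n} → Graph n → ℕ
eG G = ecount (E G)

vG : ∀ {n} → Graph n → ℕ
vG G = ∣ V G ∣

-- d₂ given number of vertices v and edges e:
-- (e-1)/(v-2) if v ≥ 3, and 1 if v = 2 (the graph K₂).
-- (v ≤ 1 never occurs for a graph with an edge; value 0 is a dummy.)
d2' : ℕ → ℕ → ℚ
d2' zero e = 0ℚ
d2' (suc zero) e = 0ℚ
d2' (suc (suc zero)) e = 1ℚ
d2' (suc (suc (suc m))) e = ((+ e) - (+ 1)) / suc m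

d₂ : ∀ {n} → Graph n → ℚ
d₂ G = d2' (vG G) (eG G)

_⊑_ : ∀ {n} → Graph n → Graph n → Set
G ⊑ H = (∀ i → i ∈ V G → i ∈ V H) × (∀ i j → E G i j ≡ true → E H i j ≡ true)

SameGraph : ∀ {n} → Graph n → Graph n → Set
SameGraph G H = (V G ≡ V H) × (∀ i j → E G i j ≡ E H i j)

StrictlyTwoBalanced : ∀ {k} → Graph k → Set
StrictlyTwoBalanced {k} F =
  (2 ≤ eG F) ×
  (∀ (F' : Graph k) → F' ⊑ F → ¬ SameGraph F' F → 1 ≤ eG F' → d₂ F' < d₂ F)

IsCopyOf : ∀ {n k} → Graph n → Graph k → Set
IsCopyOf {n} {k} G F =
  Σ (Fin k → Fin n) λ f →
    (∀ i → i ∈ V F → f i ∈ V G) ×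
    (∀ i j → i ∈ V F → j ∈ V F → f i ≡ f j → i ≡ j) ×
    (∀ j → j ∈ V G → ∃ λ i → i ∈ V F × f i ≡ j) ×
    (∀ i j → i ∈ V F → j ∈ V F → E F i j ≡ E G (f i) (f j))

private
  ∨-true : ∀ a b → a ∨ b ≡ true → (a ≡ true) Data.Sum.⊎ (b ≡ true)
  ∨-true true b _ = inj₁ refl
  ∨-true false b p = inj₂ p

_∪G_ : ∀ {n} → Graph n → Graph n → Graph n
G ∪G H = record
  { V = V G ∪ V H
  ; E = λ i j → E G i j ∨ E H i j
  ; sym = λ i j → cong₂ _∨_ (sym G i j) (sym H i j)
  ; irrefl = λ i → cong₂ _∨_ (irrefl G i) (irrefl H i)
  ; closed = λ i j p → x∈p∪q⁺ (mapS i j (∨-true (E G i j) (E H i j) p))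
  }
  where
    mapS : ∀ i j → (E G i j ≡ true) Data.Sum.⊎ (E H i j ≡ true)
         → (i ∈ V G) Data.Sum.⊎ (i ∈ V H)
    mapS i j (inj₁ q) = inj₁ (closed G i j q)
    mapS i j (inj₂ q) = inj₂ (closed H i j q)

commonEdges : ∀ {n} → Graph n → Graph n → ℕ
commonEdges G H = ecount (λ i j → E G i j ∧ E H i j)

-- Let f be the copy map from F onto F₂. Pulling F₁ back along f gives the subgraph
-- F′ = F ∩ f⁻¹(F₁) of F, which f maps isomorphically onto F₁ ∩ F₂. So F′ has at least two
-- edges, and it is a proper subgraph: otherwise F₂ ⊑ F₁, and two copies of F related by ⊑
-- coincide. Strict 2-balancedness gives d₂(F′) < d₂(F). Inclusion–exclusion for vertices and
-- edges gives v(H) + v(F′) = 2 v(F) and e(H) + e(F′) = 2 e(F) for H = F₁ ∪ F₂, so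
-- d₂(F) = (e(F) − 1)/(v(F) − 2) is the mediant of d₂(F′) and d₂(H) and lies strictly between them.

{-# OPTIONS --safe #-}
module Submission where

open import Defs hiding (sym)
open import Data.Nat using (ℕ; _≤_)
open import Data.Rational using (_<_)
import Data.Rational as ℚ
open import Relation.Nullary using (¬_)

open import Data.Bool using (Bool; true; false; _∧_; _∨_; T)
open import Data.Bool.Properties using (T-≡; ∨-identityʳ; ∧-zeroʳ; ∧-comm; ⇔→≡)
open import Data.Fin as F using (Fin; toℕ; suc)
import Data.Fin.Properties as F
open import Data.Fin.Subset as Subset using (Subset; inside; outside; ∣_∣; _∪_; _∩_; _⊆_) renaming (_∈_ to _∈ₛ_)
open import Data.Fin.Subset.Properties
  using (x∈p∩q⁺; x∈p∩q⁻; drop-∷-⊆; p⊆q⇒∣p∣≤∣q∣; ∣p∣≤∣p∪q∣; x∈p∧x≢y⇒x∈p-y; x∈p⇒∣p-x∣<∣p∣)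
import Data.Integer as ℤ
import Data.Integer.Properties as ℤ
open import Data.Integer.Solver using (module +-*-Solver)
open import Data.List using (List; []; _∷_; length; filterᵇ; map; allFin; tabulate; concatMap; cartesianProduct; _++_)
open import Data.List.Properties using (length-map; map-tabulate)
open import Data.List.Membership.Propositional using (_∈_)
open import Data.List.Membership.Propositional.Properties
  using (∈-map⁺; ∈-map⁻; ∈-filter⁺; ∈-filter⁻; ∈-allFin; ∈-cartesianProduct⁺)
open import Data.List.Membership.Propositional.Properties.WithK using (unique∧set⇒bag)
open import Data.List.Relation.Binary.BagAndSetEquality using (∼bag⇒↭)
open import Data.List.Relation.Binary.Permutation.Propositional.Properties using (↭-length)
open import Data.List.Relation.Unary.All as All using (All; []; _∷_)
import Data.List.Relation.Unary.All.Properties as All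
open import Data.List.Relation.Unary.AllPairs using ([]; _∷_)
open import Data.List.Relation.Unary.Any using (here; there)
open import Data.List.Relation.Unary.Unique.Propositional using (Unique)
import Data.List.Relation.Unary.Unique.Propositional.Properties as Unique
open import Data.Nat as ℕ using (suc; _+_; _*_; _<ᵇ_; z≤n; s≤s; s≤s⁻¹)
open import Data.Nat.Properties
  using (≤-trans; ≤-reflexive; m≤n⇒m≤1+n; n≤1+n; 1+n≰n; +-suc; +-identityʳ; *-distribˡ-+; *-cancelˡ-≡;
         *-monoʳ-≤; <-cmp; <ᵇ⇒<; <ᵇ-reflects-<)
open import Data.Product using (∃; ∃₂; _×_; _,_; proj₁; proj₂; uncurry; swap)
open import Data.Rational.Properties using (toℚᵘ-mono-<; toℚᵘ-cancel-<; toℚᵘ-fromℚᵘ)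
open import Data.Rational.Unnormalised using (mkℚᵘ; *<*)
open import Data.Rational.Unnormalised.Properties using (<-respˡ-≃; <-respʳ-≃; ≃-sym)
open import Data.Sum using (_⊎_; inj₁; inj₂; [_,_]′)
open import Data.Unit using (tt)
open import Data.Vec as Vec using ([]; _∷_; lookup; here)
open import Data.Vec.Properties using ([]=⇒lookup; lookup⇒[]=; lookup∘tabulate)
open import Function using (id; _∘_)
open import Function.Bundles using (Equivalence; _⇔_; mk⇔)
open import Relation.Binary.Definitions using (tri<; tri≈; tri>)
open import Relation.Binary.PropositionalEquality
  using (_≡_; _≢_; refl; sym; trans; cong; cong₂; subst; subst₂; ≢-sym; module ≡-Reasoning)
open import Relation.Nullary using (contradiction; yes; no)
open import Relation.Nullary.Decidable using (T?)
open import Relation.Nullary.Reflects using (ofʸ; ofⁿ; det)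

private
  variable
    A B : Set
    n : ℕ

-- Counting along lists

count : (A → Bool) → List A → ℕ
count p xs = length (filterᵇ p xs)

∈-filterᵇ⁻ : ∀ (p : A → Bool) xs {x} → x ∈ filterᵇ p xs → p x ≡ true
∈-filterᵇ⁻ p xs x∈ = Equivalence.to T-≡ (proj₂ (∈-filter⁻ (T? ∘ p) {xs = xs} x∈))

∈-filterᵇ⁺ : ∀ (p : A → Bool) {xs x} → x ∈ xs → p x ≡ true → x ∈ filterᵇ p xs
∈-filterᵇ⁺ p x∈ px = ∈-filter⁺ (T? ∘ p) x∈ (Equivalence.from T-≡ px)

record Enumeration (A : Set) : Set where
  field
    elements : List A
    unique   : Unique elements
    complete : ∀ x → x ∈ elements
open Enumeration

record _⤖ᵇ_ (p : A → Bool) (q : B → Bool) : Set where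
  field
    to         : A → B
    to-true    : ∀ {x} → p x ≡ true → q (to x) ≡ true
    injective  : ∀ {x y} → p x ≡ true → p y ≡ true → to x ≡ to y → x ≡ y
    surjective : ∀ {y} → q y ≡ true → ∃ λ x → p x ≡ true × to x ≡ y

count-false : (p : A → Bool) → (∀ x → p x ≡ false) → ∀ xs → count p xs ≡ 0
count-false p never [] = refl
count-false p never (x ∷ xs) rewrite never x = count-false p never xs

module _ {p q : A → Bool} where

  count-cong : (∀ x → p x ≡ q x) → ∀ xs → count p xs ≡ count q xs
  count-cong p≗q [] = refl
  count-cong p≗q (x ∷ xs) with p x | q x | p≗q x
  ... | true  | true  | _ = cong suc (count-cong p≗q xs)
  ... | false | false | _ = count-cong p≗q xs

  count-mono : (∀ x → p x ≡ true → q x ≡ true) → ∀ xs → count p xs ≤ count q xs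
  count-mono p⇒q [] = z≤n
  count-mono p⇒q (x ∷ xs) with p x in px | q x in qx
  ... | true  | true  = s≤s (count-mono p⇒q xs)
  ... | true  | false = contradiction (trans (sym qx) (p⇒q x px)) λ ()
  ... | false | true  = m≤n⇒m≤1+n (count-mono p⇒q xs)
  ... | false | false = count-mono p⇒q xs

  count-≤⇒⊇ : (∀ x → p x ≡ true → q x ≡ true) → ∀ xs → count q xs ≤ count p xs →
              ∀ {x} → x ∈ xs → q x ≡ true → p x ≡ true
  count-≤⇒⊇ p⇒q (y ∷ ys) q≤p (here refl) qy with p y
  ... | true = refl
  ... | false rewrite qy = contradiction (≤-trans q≤p (count-mono p⇒q ys)) 1+n≰n
  count-≤⇒⊇ p⇒q (y ∷ ys) q≤p (there x∈ys) qx with p y in py | q y in qy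
  ... | true  | true  = count-≤⇒⊇ p⇒q ys (s≤s⁻¹ q≤p) x∈ys qx
  ... | false | false = count-≤⇒⊇ p⇒q ys q≤p x∈ys qx
  ... | true  | false = contradiction (trans (sym qy) (p⇒q y py)) λ ()
  ... | false | true  = contradiction (≤-trans q≤p (count-mono p⇒q ys)) 1+n≰n

  count-∨+count-∧ : ∀ xs → count (λ x → p x ∨ q x) xs + count (λ x → p x ∧ q x) xs
                         ≡ count p xs + count q xs
  count-∨+count-∧ [] = refl
  count-∨+count-∧ (x ∷ xs) with p x | q x
  ... | true  | true  = cong suc (trans (+-suc _ _) (trans (cong suc (count-∨+count-∧ xs)) (sym (+-suc _ _))))
  ... | true  | false = cong suc (count-∨+count-∧ xs)
  ... | false | true  = trans (cong suc (count-∨+count-∧ xs)) (sym (+-suc _ _))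
  ... | false | false = count-∨+count-∧ xs

  count-∨-disjoint : (∀ x → p x ∧ q x ≡ false) →
                     ∀ xs → count (λ x → p x ∨ q x) xs ≡ count p xs + count q xs
  count-∨-disjoint disjoint xs = begin
    count p∨q xs                   ≡⟨ sym (+-identityʳ _) ⟩
    count p∨q xs + 0               ≡⟨ cong (count p∨q xs +_) (sym (count-false _ disjoint xs)) ⟩
    count p∨q xs + count p∧q xs    ≡⟨ count-∨+count-∧ xs ⟩
    count p xs + count q xs        ∎
    where
      open ≡-Reasoning
      p∨q p∧q : A → Bool
      p∨q x = p x ∨ q x
      p∧q x = p x ∧ q x

count-map : ∀ (p : B → Bool) (f : A → B) xs → count p (map f xs) ≡ count (p ∘ f) xs
count-map p f [] = refl
count-map p f (x ∷ xs) with p (f x)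
... | true  = cong suc (count-map p f xs)
... | false = count-map p f xs

unique-map-injectiveOn : ∀ (f : A → B) {xs} → (∀ {x y} → x ∈ xs → y ∈ xs → f x ≡ f y → x ≡ y) →
                         Unique xs → Unique (map f xs)
unique-map-injectiveOn f inj [] = []
unique-map-injectiveOn f inj (x∉xs ∷ xs!) =
  All.map⁺ (All.tabulate λ y∈xs fx≡fy → All.lookup x∉xs y∈xs (inj (here refl) (there y∈xs) fx≡fy))
  ∷ unique-map-injectiveOn f (λ x∈ y∈ → inj (there x∈) (there y∈)) xs!

count-⤖ᵇ : ∀ {p : A → Bool} {q : B → Bool} (X : Enumeration A) (Y : Enumeration B) →
           p ⤖ᵇ q → count p (elements X) ≡ count q (elements Y)
count-⤖ᵇ {p = p} {q} X Y p⤖q = begin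
  count p (elements X)                      ≡⟨ sym (length-map to (filterᵇ p (elements X))) ⟩
  length (map to (filterᵇ p (elements X)))  ≡⟨ ↭-length (∼bag⇒↭ (unique∧set⇒bag image! q! same-members)) ⟩
  count q (elements Y)                      ∎
  where
    open ≡-Reasoning
    open _⤖ᵇ_ p⤖q
    image! : Unique (map to (filterᵇ p (elements X)))
    image! = unique-map-injectiveOn to
      (λ x∈ y∈ → injective (∈-filterᵇ⁻ p (elements X) x∈) (∈-filterᵇ⁻ p (elements X) y∈))
      (Unique.filter⁺ (T? ∘ p) (unique X))
    q! : Unique (filterᵇ q (elements Y))
    q! = Unique.filter⁺ (T? ∘ q) (unique Y)
    same-members : ∀ {y} → y ∈ map to (filterᵇ p (elements X)) ⇔ y ∈ filterᵇ q (elements Y)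
    same-members = mk⇔
      (λ y∈ → let x , x∈ , y≡ = ∈-map⁻ to y∈ in
        subst (_∈ _) (sym y≡) (∈-filterᵇ⁺ q (complete Y (to x)) (to-true (∈-filterᵇ⁻ p (elements X) x∈))))
      (λ y∈ → let x , px , x↦y = surjective (∈-filterᵇ⁻ q (elements Y) y∈) in
        subst (_∈ _) x↦y (∈-map⁺ to (∈-filterᵇ⁺ p (complete X x) px)))

two-members : ∀ {xs : List A} → Unique xs → 2 ≤ length xs → ∃₂ λ x y → x ≢ y × x ∈ xs × y ∈ xs
two-members ((x≢y ∷ _) ∷ _) (s≤s (s≤s z≤n)) = _ , _ , x≢y , here refl , there (here refl)

two-distinct : ∀ (p : A → Bool) {xs} → Unique xs → 2 ≤ count p xs →
               ∃₂ λ x y → x ≢ y × p x ≡ true × p y ≡ true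
two-distinct p {xs} xs! 2≤ =
  let x , y , x≢y , x∈ , y∈ = two-members (Unique.filter⁺ (T? ∘ p) xs!) 2≤
  in x , y , x≢y , ∈-filterᵇ⁻ p xs x∈ , ∈-filterᵇ⁻ p xs y∈

-- Vertices and edges as counts

allFinₑ : ∀ n → Enumeration (Fin n)
allFinₑ n = record { elements = allFin n ; unique = Unique.allFin⁺ n ; complete = ∈-allFin }

concatMap≡cartesianProduct : ∀ (xs : List A) (ys : List B) →
                             concatMap (λ x → map (λ y → (x , y)) ys) xs ≡ cartesianProduct xs ys
concatMap≡cartesianProduct []       ys = refl
concatMap≡cartesianProduct (x ∷ xs) ys = cong (map (x ,_) ys ++_) (concatMap≡cartesianProduct xs ys)

pairsₑ : ∀ n → Enumeration (Fin n × Fin n)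
pairsₑ n = record
  { elements = pairs n
  ; unique   = subst Unique (sym pairs≡) (Unique.cartesianProduct⁺ (Unique.allFin⁺ n) (Unique.allFin⁺ n))
  ; complete = λ (i , j) → subst ((i , j) ∈_) (sym pairs≡) (∈-cartesianProduct⁺ (∈-allFin i) (∈-allFin j))
  }
  where
    pairs≡ : pairs n ≡ cartesianProduct (allFin n) (allFin n)
    pairs≡ = concatMap≡cartesianProduct (allFin n) (allFin n)

count-lookup-∷ : ∀ b (p : Subset n) → count (lookup (b ∷ p)) (tabulate suc) ≡ count (lookup p) (allFin n)
count-lookup-∷ {n} b p =
  trans (cong (count (lookup (b ∷ p))) (sym (map-tabulate id suc))) (count-map (lookup (b ∷ p)) suc (allFin n))

∣p∣≡count : (p : Subset n) → ∣ p ∣ ≡ count (lookup p) (allFin n)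
∣p∣≡count [] = refl
∣p∣≡count (inside  ∷ p) = cong suc (trans (∣p∣≡count p) (sym (count-lookup-∷ inside p)))
∣p∣≡count (outside ∷ p) = trans (∣p∣≡count p) (sym (count-lookup-∷ outside p))

<ᵇ≡true : ∀ {m n} → m ℕ.< n → (m <ᵇ n) ≡ true
<ᵇ≡true {m} {n} m<n = det (<ᵇ-reflects-< m n) (ofʸ m<n)

<ᵇ≡false : ∀ {m n} → ¬ m ℕ.< n → (m <ᵇ n) ≡ false
<ᵇ≡false {m} {n} m≮n = det (<ᵇ-reflects-< m n) (ofⁿ m≮n)

<ᵇ≡true⇒< : ∀ {m n} → (m <ᵇ n) ≡ true → m ℕ.< n
<ᵇ≡true⇒< {m} {n} m<ᵇn = <ᵇ⇒< m n (subst T (sym m<ᵇn) tt)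

<ᵇ-split : ∀ m n b → (m ≡ n → b ≡ false) → ((m <ᵇ n) ∧ b) ∨ ((n <ᵇ m) ∧ b) ≡ b
<ᵇ-split m n b diagonal with <-cmp m n
... | tri< m<n _ n≮m rewrite <ᵇ≡true m<n | <ᵇ≡false n≮m = ∨-identityʳ b
... | tri≈ m≮n m≡n n≮m rewrite <ᵇ≡false m≮n | <ᵇ≡false n≮m = sym (diagonal m≡n)
... | tri> m≮n _ n<m rewrite <ᵇ≡false m≮n | <ᵇ≡true n<m = refl

<ᵇ-disjoint : ∀ m n b → ((m <ᵇ n) ∧ b) ∧ ((n <ᵇ m) ∧ b) ≡ false
<ᵇ-disjoint m n b with <-cmp m n
... | tri< m<n _ n≮m rewrite <ᵇ≡true m<n | <ᵇ≡false n≮m = ∧-zeroʳ b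
... | tri≈ m≮n _ _   rewrite <ᵇ≡false m≮n = refl
... | tri> m≮n _ _   rewrite <ᵇ≡false m≮n = refl

-- ecount counts pairs i < j, an order that copy maps do not respect, so edge counts are
-- transported through ordered pairs (arcs).
arcs : (Fin n → Fin n → Bool) → ℕ
arcs {n} A = count (uncurry A) (pairs n)

arcs≡2*eG : (G : Graph n) → arcs (E G) ≡ 2 * eG G
arcs≡2*eG {n} G = begin
  arcs (E G)
    ≡⟨ count-cong (λ (i , j) → sym (<ᵇ-split (toℕ i) (toℕ j) _ (diagonal i j))) (pairs n) ⟩
  count (λ a → below a ∨ above a) (pairs n)
    ≡⟨ count-∨-disjoint (λ (i , j) → <ᵇ-disjoint (toℕ i) (toℕ j) _) (pairs n) ⟩
  eG G + count above (pairs n)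
    ≡⟨ cong (eG G +_) (sym (count-⤖ᵇ (pairsₑ n) (pairsₑ n) below⤖above)) ⟩
  eG G + eG G
    ≡⟨ cong (eG G +_) (sym (+-identityʳ _)) ⟩
  2 * eG G
    ∎
  where
    open ≡-Reasoning
    below above : Fin n × Fin n → Bool
    below (i , j) = (toℕ i <ᵇ toℕ j) ∧ E G i j
    above (i , j) = (toℕ j <ᵇ toℕ i) ∧ E G i j
    diagonal : ∀ i j → toℕ i ≡ toℕ j → E G i j ≡ false
    diagonal i j i≡j rewrite F.toℕ-injective i≡j = irrefl G j
    below⤖above : below ⤖ᵇ above
    below⤖above = record
      { to         = swap
      ; to-true    = λ {(i , j)} → trans (cong ((toℕ i <ᵇ toℕ j) ∧_) (Graph.sym G j i))
      ; injective  = λ _ _ → cong swap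
      ; surjective = λ {(i , j)} above-ij →
          (j , i) , trans (cong ((toℕ j <ᵇ toℕ i) ∧_) (Graph.sym G j i)) above-ij , refl
      }

-- Copies and subgraphs

closedʳ : (G : Graph n) → ∀ i j → E G i j ≡ true → j ∈ₛ V G
closedʳ G i j Eij = closed G j i (trans (Graph.sym G j i) Eij)

module CopyMap {k n} (G : Graph n) (F : Graph k) (copy : IsCopyOf G F) where

  f : Fin k → Fin n
  f = proj₁ copy

  f-∈ : ∀ i → i ∈ₛ V F → f i ∈ₛ V G
  f-∈ = proj₁ (proj₂ copy)

  f-injective : ∀ i j → i ∈ₛ V F → j ∈ₛ V F → f i ≡ f j → i ≡ j
  f-injective = proj₁ (proj₂ (proj₂ copy))

  f-onto : ∀ a → a ∈ₛ V G → ∃ λ i → i ∈ₛ V F × f i ≡ a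
  f-onto = proj₁ (proj₂ (proj₂ (proj₂ copy)))

  f-E : ∀ i j → i ∈ₛ V F → j ∈ₛ V F → E F i j ≡ E G (f i) (f j)
  f-E = proj₂ (proj₂ (proj₂ (proj₂ copy)))

module _ {k n} (G : Graph n) (F : Graph k) (copy : IsCopyOf G F) where

  open CopyMap G F copy

  copy-vertices : lookup (V F) ⤖ᵇ lookup (V G)
  copy-vertices = record
    { to         = f
    ; to-true    = λ {i} i∈ → []=⇒lookup (f-∈ i (lookup⇒[]= i _ i∈))
    ; injective  = λ {i} {j} i∈ j∈ → f-injective i j (lookup⇒[]= i _ i∈) (lookup⇒[]= j _ j∈)
    ; surjective = λ {a} a∈ → let i , i∈ , fi≡a = f-onto a (lookup⇒[]= a _ a∈) in i , []=⇒lookup i∈ , fi≡a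
    }

  copy-arcs : uncurry (E F) ⤖ᵇ uncurry (E G)
  copy-arcs = record
    { to         = λ (i , j) → f i , f j
    ; to-true    = λ {(i , j)} Eij → trans (sym (f-E i j (closed F i j Eij) (closedʳ F i j Eij))) Eij
    ; injective  = λ {(i , j)} {(i′ , j′)} Eij Ei′j′ fij≡ →
        cong₂ _,_ (f-injective i i′ (closed F i j Eij) (closed F i′ j′ Ei′j′) (cong proj₁ fij≡))
                  (f-injective j j′ (closedʳ F i j Eij) (closedʳ F i′ j′ Ei′j′) (cong proj₂ fij≡))
    ; surjective = λ {(a , b)} Eab →
        let i , i∈ , fi≡a = f-onto a (closed G a b Eab)
            j , j∈ , fj≡b = f-onto b (closedʳ G a b Eab)
        in (i , j) , trans (f-E i j i∈ j∈) (trans (cong₂ (E G) fi≡a fj≡b) Eab) , cong₂ _,_ fi≡a fj≡b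
    }

  vG-copy : vG G ≡ vG F
  vG-copy = begin
    ∣ V G ∣                          ≡⟨ ∣p∣≡count (V G) ⟩
    count (lookup (V G)) (allFin n)  ≡⟨ sym (count-⤖ᵇ (allFinₑ k) (allFinₑ n) copy-vertices) ⟩
    count (lookup (V F)) (allFin k)  ≡⟨ sym (∣p∣≡count (V F)) ⟩
    ∣ V F ∣                          ∎
    where open ≡-Reasoning

  eG-copy : eG G ≡ eG F
  eG-copy = *-cancelˡ-≡ (eG G) (eG F) 2 (begin
    2 * eG G    ≡⟨ sym (arcs≡2*eG G) ⟩
    arcs (E G)  ≡⟨ sym (count-⤖ᵇ (pairsₑ k) (pairsₑ n) copy-arcs) ⟩
    arcs (E F)  ≡⟨ arcs≡2*eG F ⟩
    2 * eG F    ∎)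
    where open ≡-Reasoning

∧≡true⁻ : ∀ {a b} → a ∧ b ≡ true → a ≡ true × b ≡ true
∧≡true⁻ {true} {true} _ = refl , refl

_∩G_ : Graph n → Graph n → Graph n
G ∩G H = record
  { V      = V G ∩ V H
  ; E      = λ i j → E G i j ∧ E H i j
  ; sym    = λ i j → cong₂ _∧_ (Graph.sym G i j) (Graph.sym H i j)
  ; irrefl = λ i → cong (_∧ E H i i) (irrefl G i)
  ; closed = λ i j Eij → let EGij , EHij = ∧≡true⁻ Eij in x∈p∩q⁺ (closed G i j EGij , closed H i j EHij)
  }

∣p∪q∣+∣p∩q∣≡∣p∣+∣q∣ : (p q : Subset n) → ∣ p ∪ q ∣ + ∣ p ∩ q ∣ ≡ ∣ p ∣ + ∣ q ∣
∣p∪q∣+∣p∩q∣≡∣p∣+∣q∣ [] [] = refl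
∣p∪q∣+∣p∩q∣≡∣p∣+∣q∣ (inside  ∷ p) (inside  ∷ q) =
  cong suc (trans (+-suc _ _) (trans (cong suc (∣p∪q∣+∣p∩q∣≡∣p∣+∣q∣ p q)) (sym (+-suc _ _))))
∣p∪q∣+∣p∩q∣≡∣p∣+∣q∣ (inside  ∷ p) (outside ∷ q) = cong suc (∣p∪q∣+∣p∩q∣≡∣p∣+∣q∣ p q)
∣p∪q∣+∣p∩q∣≡∣p∣+∣q∣ (outside ∷ p) (inside  ∷ q) =
  trans (cong suc (∣p∪q∣+∣p∩q∣≡∣p∣+∣q∣ p q)) (sym (+-suc _ _))
∣p∪q∣+∣p∩q∣≡∣p∣+∣q∣ (outside ∷ p) (outside ∷ q) = ∣p∪q∣+∣p∩q∣≡∣p∣+∣q∣ p q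

eG-∪+∩ : (G H : Graph n) → eG (G ∪G H) + eG (G ∩G H) ≡ eG G + eG H
eG-∪+∩ {n} G H = *-cancelˡ-≡ _ _ 2 (begin
  2 * (eG (G ∪G H) + eG (G ∩G H))        ≡⟨ *-distribˡ-+ 2 (eG (G ∪G H)) _ ⟩
  2 * eG (G ∪G H) + 2 * eG (G ∩G H)      ≡⟨ sym (cong₂ _+_ (arcs≡2*eG (G ∪G H)) (arcs≡2*eG (G ∩G H))) ⟩
  arcs (E (G ∪G H)) + arcs (E (G ∩G H))  ≡⟨ count-∨+count-∧ (pairs n) ⟩
  arcs (E G) + arcs (E H)                ≡⟨ cong₂ _+_ (arcs≡2*eG G) (arcs≡2*eG H) ⟩
  2 * eG G + 2 * eG H                    ≡⟨ sym (*-distribˡ-+ 2 (eG G) _) ⟩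
  2 * (eG G + eG H)                      ∎)
  where open ≡-Reasoning

preimage : ∀ {k} → (Fin k → Fin n) → Subset n → Subset k
preimage f p = Vec.tabulate (lookup p ∘ f)

module _ {k} {f : Fin k → Fin n} {p : Subset n} where

  ∈-preimage⁺ : ∀ {i} → f i ∈ₛ p → i ∈ₛ preimage f p
  ∈-preimage⁺ {i} fi∈ = lookup⇒[]= i _ (trans (lookup∘tabulate (lookup p ∘ f) i) ([]=⇒lookup fi∈))

  ∈-preimage⁻ : ∀ {i} → i ∈ₛ preimage f p → f i ∈ₛ p
  ∈-preimage⁻ {i} i∈ = lookup⇒[]= (f i) p (trans (sym (lookup∘tabulate (lookup p ∘ f) i)) ([]=⇒lookup i∈))

pullback : ∀ {k} → (Fin k → Fin n) → Graph k → Graph n → Graph k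
pullback f F G = record
  { V      = V F ∩ preimage f (V G)
  ; E      = λ i j → E F i j ∧ E G (f i) (f j)
  ; sym    = λ i j → cong₂ _∧_ (Graph.sym F i j) (Graph.sym G (f i) (f j))
  ; irrefl = λ i → cong (_∧ E G (f i) (f i)) (irrefl F i)
  ; closed = λ i j Eij → let EFij , EGfifj = ∧≡true⁻ Eij in
      x∈p∩q⁺ (closed F i j EFij , ∈-preimage⁺ (closed G (f i) (f j) EGfifj))
  }

pullback-⊑ : ∀ {k} (f : Fin k → Fin n) (F : Graph k) (G : Graph n) → pullback f F G ⊑ F
pullback-⊑ f F G = (λ i i∈ → proj₁ (x∈p∩q⁻ _ _ i∈)) , (λ i j Eij → proj₁ (∧≡true⁻ Eij))

module _ {k n} (F : Graph k) (G H : Graph n) (copy : IsCopyOf H F) where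

  open CopyMap H F copy

  pullback-copy : IsCopyOf (G ∩G H) (pullback f F G)
  pullback-copy =
      f
    , (λ i i∈ → let i∈F , fi∈G = x∈p∩q⁻ _ _ i∈ in x∈p∩q⁺ (∈-preimage⁻ fi∈G , f-∈ i i∈F))
    , (λ i j i∈ j∈ → f-injective i j (proj₁ (x∈p∩q⁻ _ _ i∈)) (proj₁ (x∈p∩q⁻ _ _ j∈)))
    , (λ a a∈ → let a∈G , a∈H = x∈p∩q⁻ _ _ a∈
                    i , i∈F , fi≡a = f-onto a a∈H
                in i , x∈p∩q⁺ (i∈F , ∈-preimage⁺ (subst (_∈ₛ V G) (sym fi≡a) a∈G)) , fi≡a)
    , (λ i j i∈ j∈ →
         trans (cong (_∧ E G (f i) (f j)) (f-E i j (proj₁ (x∈p∩q⁻ _ _ i∈)) (proj₁ (x∈p∩q⁻ _ _ j∈))))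
               (∧-comm (E H (f i) (f j)) _))

  pullback-whole⇒⊑ : SameGraph (pullback f F G) F → H ⊑ G
  pullback-whole⇒⊑ (V≡ , E≡) =
      (λ a a∈H → let i , i∈F , fi≡a = f-onto a a∈H in
         subst (_∈ₛ V G) fi≡a (∈-preimage⁻ (proj₂ (x∈p∩q⁻ (V F) _ (subst (i ∈ₛ_) (sym V≡) i∈F)))))
    , (λ a b Eab → let i , i∈F , fi≡a = f-onto a (closed H a b Eab)
                       j , j∈F , fj≡b = f-onto b (closedʳ H a b Eab)
                       EFij = trans (f-E i j i∈F j∈F) (trans (cong₂ (E H) fi≡a fj≡b) Eab)
                   in subst₂ (λ x y → E G x y ≡ true) fi≡a fj≡b (proj₂ (∧≡true⁻ (trans (E≡ i j) EFij))))

p⊆q∧∣q∣≤∣p∣⇒p≡q : {p q : Subset n} → p ⊆ q → ∣ q ∣ ≤ ∣ p ∣ → p ≡ q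
p⊆q∧∣q∣≤∣p∣⇒p≡q {p = []} {[]} _ _ = refl
p⊆q∧∣q∣≤∣p∣⇒p≡q {p = inside ∷ p} {inside ∷ q} p⊆q ∣q∣≤∣p∣ =
  cong (inside ∷_) (p⊆q∧∣q∣≤∣p∣⇒p≡q (drop-∷-⊆ p⊆q) (s≤s⁻¹ ∣q∣≤∣p∣))
p⊆q∧∣q∣≤∣p∣⇒p≡q {p = outside ∷ p} {outside ∷ q} p⊆q ∣q∣≤∣p∣ =
  cong (outside ∷_) (p⊆q∧∣q∣≤∣p∣⇒p≡q (drop-∷-⊆ p⊆q) ∣q∣≤∣p∣)
p⊆q∧∣q∣≤∣p∣⇒p≡q {p = inside ∷ p} {outside ∷ q} p⊆q _ = contradiction (p⊆q here) λ ()
p⊆q∧∣q∣≤∣p∣⇒p≡q {p = outside ∷ p} {inside ∷ q} p⊆q ∣q∣≤∣p∣ =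
  contradiction (≤-trans ∣q∣≤∣p∣ (p⊆q⇒∣p∣≤∣q∣ (drop-∷-⊆ p⊆q))) 1+n≰n

⊑∧size≤⇒SameGraph : (G H : Graph n) → H ⊑ G → vG G ≤ vG H → eG G ≤ eG H → SameGraph G H
⊑∧size≤⇒SameGraph {n} G H (V⊆ , E⊆) vG≤ eG≤ =
    sym (p⊆q∧∣q∣≤∣p∣⇒p≡q (λ {i} → V⊆ i) vG≤)
  , λ i j → ⇔→≡ (mk⇔ (count-≤⇒⊇ (λ (a , b) → E⊆ a b) (pairs n) arcs≤ (complete (pairsₑ n) (i , j)))
                      (E⊆ i j))
  where
    arcs≤ : arcs (E G) ≤ arcs (E H)
    arcs≤ = subst₂ _≤_ (sym (arcs≡2*eG G)) (sym (arcs≡2*eG H)) (*-monoʳ-≤ 2 eG≤)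

distinct⊆⇒length≤∣p∣ : {p : Subset n} {xs : List (Fin n)} →
                       Unique xs → All (_∈ₛ p) xs → length xs ≤ ∣ p ∣
distinct⊆⇒length≤∣p∣ [] [] = z≤n
distinct⊆⇒length≤∣p∣ {p = p} {x ∷ xs} (x∉xs ∷ xs!) (x∈p ∷ xs⊆p) =
  ≤-trans (s≤s (distinct⊆⇒length≤∣p∣ xs! xs⊆p-x)) (x∈p⇒∣p-x∣<∣p∣ x∈p)
  where
    xs⊆p-x : All (_∈ₛ p Subset.- x) xs
    xs⊆p-x = All.zipWith (λ (y∈p , x≢y) → x∈p∧x≢y⇒x∈p-y y∈p (≢-sym x≢y)) (xs⊆p , x∉xs)

third-endpoint : {a b c d : Fin n} → a F.< b → c F.< d → (a , b) ≢ (c , d) →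
                 ∃ λ x → (x ≡ c ⊎ x ≡ d) × x ≢ a × x ≢ b
third-endpoint {a = a} {b} {c} {d} a<b c<d ab≢cd with c F.≟ a | c F.≟ b
... | no c≢a   | no c≢b   = c , inj₁ refl , c≢a , c≢b
... | yes refl | _        = d , inj₂ refl , (λ { refl → F.<-irrefl refl c<d }) , (λ { refl → ab≢cd refl })
... | no _     | yes refl = d , inj₂ refl , (λ { refl → F.<-asym a<b c<d }) , (λ { refl → F.<-irrefl refl c<d })

three-vertices : (G : Graph n) → 2 ≤ eG G → 3 ≤ vG G
three-vertices {n} G 2≤eG =
  let (a , b) , (c , d) , ab≢cd , below-ab , below-cd = two-distinct _ (unique (pairsₑ n)) 2≤eG
      a<ᵇb , Eab = ∧≡true⁻ below-ab
      c<ᵇd , Ecd = ∧≡true⁻ below-cd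
      x , x≡c⊎x≡d , x≢a , x≢b = third-endpoint (<ᵇ≡true⇒< a<ᵇb) (<ᵇ≡true⇒< c<ᵇd) ab≢cd
      x∈V = [ (λ x≡c → subst (_∈ₛ V G) (sym x≡c) (closed G c d Ecd))
            , (λ x≡d → subst (_∈ₛ V G) (sym x≡d) (closedʳ G c d Ecd)) ]′ x≡c⊎x≡d
  in distinct⊆⇒length≤∣p∣ ((F.<⇒≢ (<ᵇ≡true⇒< a<ᵇb) ∷ ≢-sym x≢a ∷ []) ∷ (≢-sym x≢b ∷ []) ∷ [] ∷ [])
                          (closed G a b Eab ∷ closedʳ G a b Eab ∷ x∈V ∷ [])

-- Arithmetic of d₂

module Mediant where

  open import Data.Integer using (+_; _-_; -_)
  open import Data.Integer.Properties using (pos-+)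

  /<⇒*< : ∀ x y a b → x ℚ./ suc a < y ℚ./ suc b → x ℤ.* + suc b ℤ.< y ℤ.* + suc a
  /<⇒*< x y a b x/a<y/b
    with <-respʳ-≃ (toℚᵘ-fromℚᵘ (mkℚᵘ y b))
                   (<-respˡ-≃ (toℚᵘ-fromℚᵘ (mkℚᵘ x a)) (toℚᵘ-mono-< x/a<y/b))
  ... | *<* xb<ya = xb<ya

  *<⇒/< : ∀ x y a b → x ℤ.* + suc b ℤ.< y ℤ.* + suc a → x ℚ./ suc a < y ℚ./ suc b
  *<⇒/< x y a b xb<ya =
    toℚᵘ-cancel-< (<-respʳ-≃ (≃-sym (toℚᵘ-fromℚᵘ (mkℚᵘ y b)))
                             (<-respˡ-≃ (≃-sym (toℚᵘ-fromℚᵘ (mkℚᵘ x a))) (*<* xb<ya)))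

  +-cancelʳ-< : ∀ {i j} k → i ℤ.+ k ℤ.< j ℤ.+ k → i ℤ.< j
  +-cancelʳ-< {i} {j} k i+k<j+k = subst₂ ℤ._<_ (i+k-k≡i i) (i+k-k≡i j) (ℤ.+-monoˡ-< (- k) i+k<j+k)
    where
      i+k-k≡i : ∀ m → m ℤ.+ k - k ≡ m
      i+k-k≡i m = trans (ℤ.+-assoc m k (- k)) (trans (cong (ℤ._+_ m) (ℤ.+-inverseʳ k)) (ℤ.+-identityʳ m))

  -- y/b is the mediant of x/a and z/h, hence lies strictly between them.
  mediant-mirror : ∀ {x y z a b h} → x ℤ.* b ℤ.< y ℤ.* a → z ℤ.+ x ≡ y ℤ.+ y → h ℤ.+ a ≡ b ℤ.+ b →
                   y ℤ.* h ℤ.< z ℤ.* b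
  mediant-mirror {x} {y} {z} {a} {b} {h} xb<ya z+x≡y+y h+a≡b+b = +-cancelʳ-< (y ℤ.* a) (begin-strict
    y ℤ.* h ℤ.+ y ℤ.* a  ≡⟨ sym (ℤ.*-distribˡ-+ y h a) ⟩
    y ℤ.* (h ℤ.+ a)      ≡⟨ cong (y ℤ.*_) h+a≡b+b ⟩
    y ℤ.* (b ℤ.+ b)      ≡⟨ trans (ℤ.*-distribˡ-+ y b b) (sym (ℤ.*-distribʳ-+ b y y)) ⟩
    (y ℤ.+ y) ℤ.* b      ≡⟨ cong (ℤ._* b) (sym z+x≡y+y) ⟩
    (z ℤ.+ x) ℤ.* b      ≡⟨ ℤ.*-distribʳ-+ b z x ⟩
    z ℤ.* b ℤ.+ x ℤ.* b  <⟨ ℤ.+-monoʳ-< (z ℤ.* b) xb<ya ⟩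
    z ℤ.* b ℤ.+ y ℤ.* a  ∎)
    where open ℤ.≤-Reasoning

  shifted-sum : ∀ c u v w → u + v ≡ w + w → (+ u - c) ℤ.+ (+ v - c) ≡ (+ w - c) ℤ.+ (+ w - c)
  shifted-sum c u v w u+v≡w+w = begin
    (+ u - c) ℤ.+ (+ v - c)    ≡⟨ regroup (+ u) (+ v) c ⟩
    (+ u ℤ.+ + v) - (c ℤ.+ c)  ≡⟨ cong (_- (c ℤ.+ c)) +u++v≡+w++w ⟩
    (+ w ℤ.+ + w) - (c ℤ.+ c)  ≡⟨ sym (regroup (+ w) (+ w) c) ⟩
    (+ w - c) ℤ.+ (+ w - c)    ∎
    where
      open ≡-Reasoning
      open +-*-Solver
      regroup : ∀ p q c → (p - c) ℤ.+ (q - c) ≡ (p ℤ.+ q) - (c ℤ.+ c)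
      regroup = solve 3 (λ p q c → (p :- c) :+ (q :- c) := (p :+ q) :- (c :+ c)) refl
      +u++v≡+w++w : + u ℤ.+ + v ≡ + w ℤ.+ + w
      +u++v≡+w++w = trans (sym (pos-+ u v)) (trans (cong +_ u+v≡w+w) (pos-+ w w))

  -- For v ≥ 3 the denominator of d2' v e is v − 2, which is what + v - + 2 computes to; so
  -- shifted-sum relates the denominators (c = 2) as well as the numerators e − 1 (c = 1).
  d2'-mirror : ∀ {vF eF vS eS vH eH} → 3 ≤ vS → 3 ≤ vF → 3 ≤ vH →
               vH + vS ≡ vF + vF → eH + eS ≡ eF + eF → d2' vS eS < d2' vF eF → d2' vF eF < d2' vH eH
  d2'-mirror {eF = eF} {eS = eS} {eH = eH}
    (s≤s (s≤s (s≤s (z≤n {a})))) (s≤s (s≤s (s≤s (z≤n {b})))) (s≤s (s≤s (s≤s (z≤n {h})))) v-sum e-sum dS<dF =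
    *<⇒/< (+ eF - + 1) (+ eH - + 1) b h
      (mediant-mirror {+ eS - + 1} {+ eF - + 1} {+ eH - + 1} {+ suc a} {+ suc b} {+ suc h}
        (/<⇒*< (+ eS - + 1) (+ eF - + 1) a b dS<dF)
        (shifted-sum (+ 1) eH eS eF e-sum)
        (shifted-sum (+ 2) (3 + h) (3 + a) (3 + b) v-sum))

open Mediant using (d2'-mirror)

module TwoCopies {k n} (F : Graph k) (F₁ F₂ : Graph n) (copy₁ : IsCopyOf F₁ F) (copy₂ : IsCopyOf F₂ F) where

  shared : Graph k
  shared = pullback (proj₁ copy₂) F F₁

  shared-copy : IsCopyOf (F₁ ∩G F₂) shared
  shared-copy = pullback-copy F F₁ F₂ copy₂

  eG-shared : eG shared ≡ commonEdges F₁ F₂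
  eG-shared = sym (eG-copy (F₁ ∩G F₂) shared shared-copy)

  vG-∪+shared : vG (F₁ ∪G F₂) + vG shared ≡ vG F + vG F
  vG-∪+shared = begin
    vG (F₁ ∪G F₂) + vG shared     ≡⟨ cong (vG (F₁ ∪G F₂) +_) (sym (vG-copy (F₁ ∩G F₂) shared shared-copy)) ⟩
    vG (F₁ ∪G F₂) + vG (F₁ ∩G F₂) ≡⟨ ∣p∪q∣+∣p∩q∣≡∣p∣+∣q∣ (V F₁) (V F₂) ⟩
    vG F₁ + vG F₂                 ≡⟨ cong₂ _+_ (vG-copy F₁ F copy₁) (vG-copy F₂ F copy₂) ⟩
    vG F + vG F                   ∎
    where open ≡-Reasoning

  eG-∪+shared : eG (F₁ ∪G F₂) + eG shared ≡ eG F + eG F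
  eG-∪+shared = begin
    eG (F₁ ∪G F₂) + eG shared     ≡⟨ cong (eG (F₁ ∪G F₂) +_) eG-shared ⟩
    eG (F₁ ∪G F₂) + eG (F₁ ∩G F₂) ≡⟨ eG-∪+∩ F₁ F₂ ⟩
    eG F₁ + eG F₂                 ≡⟨ cong₂ _+_ (eG-copy F₁ F copy₁) (eG-copy F₂ F copy₂) ⟩
    eG F + eG F                   ∎
    where open ≡-Reasoning

  vG≤vG-∪ : vG F ≤ vG (F₁ ∪G F₂)
  vG≤vG-∪ = subst (_≤ vG (F₁ ∪G F₂)) (vG-copy F₁ F copy₁) (∣p∣≤∣p∪q∣ (V F₁) (V F₂))

  shared-proper : ¬ SameGraph F₁ F₂ → ¬ SameGraph shared F
  shared-proper F₁≢F₂ shared≡F =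
    F₁≢F₂ (⊑∧size≤⇒SameGraph F₁ F₂ (pullback-whole⇒⊑ F F₁ F₂ copy₂ shared≡F)
             (≤-reflexive (trans (vG-copy F₁ F copy₁) (sym (vG-copy F₂ F copy₂))))
             (≤-reflexive (trans (eG-copy F₁ F copy₁) (sym (eG-copy F₂ F copy₂)))))

proposition5p3 : ∀ {k n : ℕ} (F : Graph k) (F₁ F₂ : Graph n) →
    StrictlyTwoBalanced F →
    IsCopyOf F₁ F → IsCopyOf F₂ F →
    ¬ SameGraph F₁ F₂ →
    2 ≤ commonEdges F₁ F₂ →
    d₂ F < d₂ (F₁ ∪G F₂)
proposition5p3 F F₁ F₂ (2≤eF , balanced) copy₁ copy₂ F₁≢F₂ 2≤common =
  d2'-mirror (three-vertices shared 2≤e-shared) 3≤vF (≤-trans 3≤vF vG≤vG-∪) vG-∪+shared eG-∪+shared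
             (balanced shared (pullback-⊑ _ F F₁) (shared-proper F₁≢F₂) (≤-trans (n≤1+n 1) 2≤e-shared))
  where
    open TwoCopies F F₁ F₂ copy₁ copy₂
    3≤vF : 3 ≤ vG F
    3≤vF = three-vertices F 2≤eF
    2≤e-shared : 2 ≤ eG shared
    2≤e-shared = subst (2 ≤_) (sym eG-shared) 2≤common
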